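{- Let $G=(V,E)$ be a simple undirected graph with $m$ edges and maximum degree $\Delta$, let $\chi$ be any partial $(\Delta+1)$-edge coloring of $G$, and let $x\in\{1,\dots,\Delta+1\}$. For each $y\in\{1,\dots,\Delta+1\}\setminus\{x\}$, let $L_{x,y}$ denote the total length (number of edges) of all maximal $\{x,y\}$-alternating paths under $\chi$ that have length at least $2$. Then $\sum_{y\neq x}L_{x,y}<3m$.
   Context: A partial $(\Delta+1)$-edge coloring of $G$ is a map $\chi:E\to\{1,\dots,\Delta+1\}\cup\{\bot\}$ ($\bot$ meaning uncolored) such that any two colored edges sharing an endpoint receive distinct colors. For a vertex $w$, $\mathsf{miss}_\chi(w)$ is the set of colors in $\{1,\dots,\Delta+1\}$ not used by $\chi$ on edges incident on $w$. For distinct colors $x,y$, a simple path $P$ with endpoints $s,t$ is an $\{x,y\}$-alternating path under $\chi$ if every edge of $P$ is colored $x$ or $y$ (consecutive edges thus alternate between the two colors); it is maximal if $\{x,y\}\cap\mathsf{miss}_\chi(s)\neq\emptyset$ and $\{x,y\}\cap\mathsf{miss}_\chi(t)\neq\emptyset$. -}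

module Defs where

open import Data.Nat using (ℕ; zero; suc; _+_; _∸_; _≤_)
open import Data.Fin using (Fin; _<?_; _≟_)
import Data.Fin as F
open import Data.Bool using (Bool; true; false; if_then_else_; _∧_)
open import Data.Maybe using (Maybe; just; nothing)
open import Data.List using (List; length; head; last; reverse; map)
open import Data.Nat.ListAction using (sum)
open import Data.List.Membership.Propositional using (_∈_)
open import Data.List.Relation.Unary.Unique.Propositional using (Unique)
open import Data.List.Relation.Unary.Linked using (Linked)
open import Data.List.Relation.Unary.AllPairs using (AllPairs)
open import Data.Product using (_×_; Σ)
open import Data.Sum using (_⊎_)
open import Relation.Nullary using (¬_)
open import Relation.Nullary.Decidable using (⌊_⌋)
open import Relation.Binary.PropositionalEquality using (_≡_; _≢_)

sumF : ∀ {n} → (Fin n → ℕ) → ℕ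
sumF {zero}  f = 0
sumF {suc n} f = f F.zero + sumF (λ i → f (F.suc i))

record Graph (n : ℕ) : Set where
  field
    adj    : Fin n → Fin n → Bool
    sym    : ∀ u v → adj u v ≡ adj v u
    irrefl : ∀ u → adj u u ≡ false
open Graph public

deg : ∀ {n} → Graph n → Fin n → ℕ
deg G u = sumF (λ v → if adj G u v then 1 else 0)

numEdges : ∀ {n} → Graph n → ℕ
numEdges G = sumF (λ u → sumF (λ v → if adj G u v ∧ ⌊ u <? v ⌋ then 1 else 0))

-- Δ is the maximum degree of G (least upper bound of the degrees; 0 for the empty graph).
IsMaxDegree : ∀ {n} → Graph n → ℕ → Set
IsMaxDegree G Δ = (∀ u → deg G u ≤ Δ) × (∀ d → (∀ u → deg G u ≤ d) → Δ ≤ d)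

-- Colors {1,…,Δ+1} are represented by Fin (suc Δ); nothing = ⊥ (uncolored).
-- χ u v is the color of edge {u,v}.
record PartialColoring {n} (G : Graph n) (Δ : ℕ) : Set where
  field
    col       : Fin n → Fin n → Maybe (Fin (suc Δ))
    col-sym   : ∀ u v → col u v ≡ col v u
    col-edges : ∀ u v → adj G u v ≡ false → col u v ≡ nothing
    proper    : ∀ u v w c → col u v ≡ just c → col u w ≡ just c → v ≡ w
open PartialColoring public

Miss : ∀ {n} {G : Graph n} {Δ} → PartialColoring G Δ → Fin n → Fin (suc Δ) → Set
Miss χ w c = ∀ v → col χ w v ≢ just c

XYEdge : ∀ {n} {G : Graph n} {Δ} → PartialColoring G Δ → Fin (suc Δ) → Fin (suc Δ) →
         Fin n → Fin n → Set
XYEdge χ x y u v = (col χ u v ≡ just x) ⊎ (col χ u v ≡ just y)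

-- A path is given by its vertex sequence; its length is the number of edges.
pathLength : ∀ {n} → List (Fin n) → ℕ
pathLength P = length P ∸ 1

IsAltPath : ∀ {n} {G : Graph n} {Δ} → PartialColoring G Δ → Fin (suc Δ) → Fin (suc Δ) →
            List (Fin n) → Set
IsAltPath χ x y P = Unique P × Linked (XYEdge χ x y) P

IsMaximalAltPath : ∀ {n} {G : Graph n} {Δ} → PartialColoring G Δ → Fin (suc Δ) → Fin (suc Δ) →
                   List (Fin n) → Set
IsMaximalAltPath χ x y P =
  IsAltPath χ x y P ×
  Σ _ (λ s → Σ _ (λ t → head P ≡ just s × last P ≡ just t ×
     (Miss χ s x ⊎ Miss χ s y) × (Miss χ t x ⊎ Miss χ t y)))

-- The list Ps enumerates exactly the maximal {x,y}-alternating paths of length ≥ 2,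
-- each exactly once (a path and its reversal being the same path).
EnumeratesLongMaxAltPaths : ∀ {n} {G : Graph n} {Δ} → PartialColoring G Δ →
  Fin (suc Δ) → Fin (suc Δ) → List (List (Fin n)) → Set
EnumeratesLongMaxAltPaths χ x y Ps =
  (∀ P → P ∈ Ps → IsMaximalAltPath χ x y P × 2 ≤ pathLength P) ×
  (∀ P → IsMaximalAltPath χ x y P → 2 ≤ pathLength P → (P ∈ Ps) ⊎ (reverse P ∈ Ps)) ×
  AllPairs (λ P Q → P ≢ Q × P ≢ reverse Q) Ps

totalLength : ∀ {n} → List (List (Fin n)) → ℕ
totalLength Ps = sum (map pathLength Ps)

sumOverOthers : ∀ {n Δ} → Fin (suc Δ) → ((y : Fin (suc Δ)) → List (List (Fin n))) → ℕ
sumOverOthers x Ps = sumF (λ y → if ⌊ y ≟ x ⌋ then 0 else totalLength (Ps y))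

-- Fix y ≠ x. Consecutive edges of an {x,y}-alternating path have different colours, so a path
-- with ℓ ≥ 2 edges contains an edge coloured x and c ≥ 1 edges coloured y, with ℓ ≤ 2c + 1 ≤ 3c.
-- A maximal alternating path is determined by any one of its edges: an inner vertex has two
-- {x,y}-neighbours, so it misses neither x nor y and has no third such neighbour, and the path
-- can neither stop nor branch there. Hence distinct maximal paths share no y-edge, and
-- L_{x,y} ≤ 3 |E_y| for the colour class E_y. Summing over y ≠ x bounds the total by
-- 3 (m − |E_x|), which is < 3m unless E_x is empty; but then no alternating path has two edges.

module Submission where

import Algebra.Properties.Semiring.Sum as Semiring
open import Data.Bool using (Bool; true; false; if_then_else_; _∧_; not)
open import Data.Fin as Fin using (Fin; zero; suc; _≟_; _<?_; punchIn)
open import Data.Fin.Properties using (punchInᵢ≢i; ≤∧≢⇒<)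
open import Data.List using (List; []; _∷_; _++_; _ʳ++_; length; head; last; reverse; map; concatMap; filter)
open import Data.List.Membership.Propositional using (_∈_)
open import Data.List.Membership.Propositional.Properties using (∈-++⁺ʳ; ∈-map∘filter⁻)
open import Data.List.Properties
  using ( unfold-reverse; reverse-++; ʳ++-defn; ++-assoc; reverse-involutive; reverse-injective
        ; length-++; length-map; filter-accept; filter-some)
open import Data.List.Relation.Binary.Disjoint.Propositional using (Disjoint)
open import Data.List.Relation.Unary.All as All using (All; []; _∷_)
open import Data.List.Relation.Unary.All.Properties using (all-filter; concat⁺) renaming (map⁺ to All-map⁺)
open import Data.List.Relation.Unary.AllPairs as AllPairs using (AllPairs; []; _∷_)
import Data.List.Relation.Unary.AllPairs.Properties as AllPairs
open import Data.List.Relation.Unary.Any as Any using (Any; here; there)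
open import Data.List.Relation.Unary.Linked as Linked using (Linked; []; [-]; _∷_)
import Data.List.Relation.Unary.Linked.Properties as Linked
open import Data.List.Relation.Unary.Unique.Propositional using (Unique)
import Data.List.Relation.Unary.Unique.Propositional.Properties as Unique
open import Data.Maybe using (Maybe; just; nothing)
open import Data.Maybe.Properties using (just-injective) renaming (≡-dec to ≡-dec-Maybe)
open import Data.Maybe.Relation.Binary.Connected as Connected using (Connected)
open import Data.Maybe.Relation.Unary.All using (just) renaming (All to MaybeAll)
open import Data.Nat using (ℕ; zero; suc; _+_; _*_; _≤_; _<_; z≤n; s≤s)
open import Data.Nat.ListAction using (sum)
import Data.Nat.Properties as ℕ
open import Data.Nat.Properties
  using ( +-comm; +-identityʳ; *-distribˡ-+; *-suc; ≤-reflexive; ≤-trans; m≤n⇒m≤1+n; m<m+n; n≢0⇒n>0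
        ; +-mono-≤; +-monoˡ-≤; *-monoʳ-≤; *-monoʳ-<; module ≤-Reasoning)
open import Data.Product using (_×_; _,_; proj₁; proj₂; uncurry; swap; ∃; ∃₂)
open import Data.Product.Properties using (≡-dec)
open import Data.Empty using (⊥-elim)
open import Data.Sum as Sum using (_⊎_; inj₁; inj₂)
open import Function using (_∘_)
open import Relation.Binary.Definitions using (Decidable; Symmetric)
open import Relation.Binary.PropositionalEquality
  using (_≡_; _≢_; refl; sym; trans; cong; cong₂; subst; module ≡-Reasoning)
  renaming (setoid to ≡-setoid)
open import Relation.Nullary using (¬_; Dec; yes; no; does; ¬?; _×-dec_; contradiction)
open import Relation.Nullary.Decidable using (dec-true; dec-false; isYes≗does)
import Relation.Unary as U

open Semiring ℕ.+-*-semiring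
  using (sum-syntax; sum-cong-≗; sum-replicate-zero; sum-remove; ∑-distrib-+; ∑-comm; *-distribˡ-sum)

open import Defs hiding (sym)

-- Finite sums

𝟙 : Bool → ℕ
𝟙 b = if b then 1 else 0

sumF≗∑ : ∀ {n} {f g : Fin n → ℕ} → (∀ i → f i ≡ g i) → sumF f ≡ ∑[ i < n ] g i
sumF≗∑ {zero}  f≡g = refl
sumF≗∑ {suc n} f≡g = cong₂ _+_ (f≡g zero) (sumF≗∑ (f≡g ∘ suc))

∑-mono-≤ : ∀ {n} {f g : Fin n → ℕ} → (∀ i → f i ≤ g i) → ∑[ i < n ] f i ≤ ∑[ i < n ] g i
∑-mono-≤ {zero}  _   = z≤n
∑-mono-≤ {suc n} f≤g = +-mono-≤ (f≤g zero) (∑-mono-≤ (f≤g ∘ suc))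

∑-zero : ∀ {n} (f : Fin n → ℕ) → (∀ i → f i ≡ 0) → ∑[ i < n ] f i ≡ 0
∑-zero {n} f f≡0 = trans (sum-cong-≗ f≡0) (sum-replicate-zero n)

∑-single : ∀ {n} (f : Fin n → ℕ) j → (∀ i → i ≢ j → f i ≡ 0) → ∑[ i < n ] f i ≡ f j
∑-single {suc n} f j f≡0 = begin
  ∑[ i < _ ] f i
    ≡⟨ sum-remove {i = j} f ⟩
  f j + ∑[ i < _ ] f (punchIn j i)
    ≡⟨ cong (f j +_) (∑-zero (f ∘ punchIn j) (f≡0 _ ∘ punchInᵢ≢i j)) ⟩
  f j + 0
    ≡⟨ +-identityʳ (f j) ⟩
  f j ∎
  where open ≡-Reasoning

∑-except : ∀ {n} → Fin n → (Fin n → ℕ) → ℕ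
∑-except {n} x f = ∑[ y < n ] (if does (y ≟ x) then 0 else f y)

∑-except≡∑-punchIn : ∀ {n} x (f : Fin (suc n) → ℕ) → ∑-except x f ≡ ∑[ i < n ] f (punchIn x i)
∑-except≡∑-punchIn x f = begin
  ∑-except x f                              ≡⟨ sum-remove {i = x} off ⟩
  off x + ∑[ i < _ ] off (punchIn x i)      ≡⟨ cong₂ _+_ off-x (sum-cong-≗ off-punchIn) ⟩
  ∑[ i < _ ] f (punchIn x i)                ∎
  where
  open ≡-Reasoning
  off : Fin _ → ℕ
  off y = if does (y ≟ x) then 0 else f y
  off-x : off x ≡ 0
  off-x = cong (λ b → if b then 0 else f x) (dec-true (x ≟ x) refl)
  off-punchIn : ∀ i → off (punchIn x i) ≡ f (punchIn x i)
  off-punchIn i =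
    cong (λ b → if b then 0 else f (punchIn x i)) (dec-false (punchIn x i ≟ x) (punchInᵢ≢i x i))

∑-except-+ : ∀ {n} x (f : Fin (suc n) → ℕ) → ∑-except x f + f x ≡ ∑[ y < suc n ] f y
∑-except-+ x f = begin
  ∑-except x f + f x                  ≡⟨ cong (_+ f x) (∑-except≡∑-punchIn x f) ⟩
  ∑[ i < _ ] f (punchIn x i) + f x    ≡⟨ +-comm _ (f x) ⟩
  f x + ∑[ i < _ ] f (punchIn x i)    ≡⟨ sum-remove {i = x} f ⟨
  ∑[ y < _ ] f y                      ∎
  where open ≡-Reasoning

∑-except-zero : ∀ {n} x (f : Fin (suc n) → ℕ) → (∀ y → y ≢ x → f y ≡ 0) → ∑-except x f ≡ 0
∑-except-zero x f f≡0 =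
  trans (∑-except≡∑-punchIn x f) (∑-zero (f ∘ punchIn x) (λ i → f≡0 _ (punchInᵢ≢i x i)))

∑-except-≤-* : ∀ {n} x k (f g : Fin (suc n) → ℕ) → (∀ y → y ≢ x → f y ≤ k * g y) →
               ∑-except x f ≤ k * ∑-except x g
∑-except-≤-* x k f g f≤kg = begin
  ∑-except x f                        ≡⟨ ∑-except≡∑-punchIn x f ⟩
  ∑[ i < _ ] f (punchIn x i)          ≤⟨ ∑-mono-≤ (λ i → f≤kg _ (punchInᵢ≢i x i)) ⟩
  ∑[ i < _ ] (k * g (punchIn x i))    ≡⟨ *-distribˡ-sum k (g ∘ punchIn x) ⟨
  k * (∑[ i < _ ] g (punchIn x i))    ≡⟨ cong (k *_) (∑-except≡∑-punchIn x g) ⟨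
  k * ∑-except x g                    ∎
  where open ≤-Reasoning

-- Counting pairs

module _ {m n : ℕ} where

  card : {P : Fin m → Fin n → Set} → Decidable P → ℕ
  card P? = ∑[ u < m ] ∑[ v < n ] 𝟙 (does (P? u v))

  private
    _≟²_ : (e e′ : Fin m × Fin n) → _
    _≟²_ = ≡-dec _≟_ _≟_

  _∖_ : {P : Fin m → Fin n → Set} → Decidable P → (e : Fin m × Fin n) →
        Decidable (λ u v → P u v × (u , v) ≢ e)
  (P? ∖ e) u v = P? u v ×-dec ¬? ((u , v) ≟² e)

  ∑∑-indicator : (e : Fin m × Fin n) → ∑[ u < m ] ∑[ v < n ] 𝟙 (does ((u , v) ≟² e)) ≡ 1
  ∑∑-indicator (a , b) = begin
    ∑[ u < m ] ∑[ v < n ] δ u v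
      ≡⟨ ∑-single _ a (λ u u≢a → ∑-zero (δ u) (λ v → δ-off u v (u≢a ∘ cong proj₁))) ⟩
    ∑[ v < n ] δ a v
      ≡⟨ ∑-single (δ a) b (λ v v≢b → δ-off a v (v≢b ∘ cong proj₂)) ⟩
    δ a b
      ≡⟨ cong 𝟙 (dec-true ((a , b) ≟² (a , b)) refl) ⟩
    1 ∎
    where
    open ≡-Reasoning
    δ : Fin m → Fin n → ℕ
    δ u v = 𝟙 (does ((u , v) ≟² (a , b)))
    δ-off : ∀ u v → (u , v) ≢ (a , b) → δ u v ≡ 0
    δ-off u v ≢ab = cong 𝟙 (dec-false ((u , v) ≟² (a , b)) ≢ab)

  card-∖ : {P : Fin m → Fin n → Set} (P? : Decidable P) → ∀ {a b} → P a b →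
           card P? ≡ suc (card (P? ∖ (a , b)))
  card-∖ P? {a} {b} pab = begin
    card P?
      ≡⟨ sum-cong-≗ (λ u → sum-cong-≗ (split u)) ⟩
    ∑[ u < m ] ∑[ v < n ] (rest u v + δ u v)
      ≡⟨ sum-cong-≗ (λ u → ∑-distrib-+ (rest u) (δ u)) ⟩
    ∑[ u < m ] (∑[ v < n ] rest u v + ∑[ v < n ] δ u v)
      ≡⟨ ∑-distrib-+ (λ u → ∑[ v < n ] rest u v) _ ⟩
    card (P? ∖ (a , b)) + ∑[ u < m ] ∑[ v < n ] δ u v
      ≡⟨ cong (card (P? ∖ (a , b)) +_) (∑∑-indicator (a , b)) ⟩
    card (P? ∖ (a , b)) + 1
      ≡⟨ +-comm _ 1 ⟩
    suc (card (P? ∖ (a , b))) ∎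
    where
    open ≡-Reasoning
    δ rest : Fin m → Fin n → ℕ
    δ u v = 𝟙 (does ((u , v) ≟² (a , b)))
    rest u v = 𝟙 (does ((P? ∖ (a , b)) u v))
    split : ∀ u v → 𝟙 (does (P? u v)) ≡ 𝟙 (does (P? u v) ∧ not (does ((u , v) ≟² (a , b))))
                                        + 𝟙 (does ((u , v) ≟² (a , b)))
    split u v with P? u v | (u , v) ≟² (a , b)
    ... | yes _ | yes _    = refl
    ... | yes _ | no _     = refl
    ... | no ¬p | yes refl = contradiction pab ¬p
    ... | no _  | no _     = refl

  length≤card : {P : Fin m → Fin n → Set} (P? : Decidable P) {l : List (Fin m × Fin n)} →
                Unique l → All (uncurry P) l → length l ≤ card P?
  length≤card P? [] [] = z≤n
  length≤card P? {(a , b) ∷ l} (e∉l ∷ u) (pab ∷ ps) = begin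
    suc (length l)
      ≤⟨ s≤s (length≤card (P? ∖ (a , b)) u (All.zipWith (λ (p , ≢e) → p , ≢e ∘ sym) (ps , e∉l))) ⟩
    suc (card (P? ∖ (a , b)))
      ≡⟨ card-∖ P? pab ⟨
    card P? ∎
    where open ≤-Reasoning

sum-map≤*length-concatMap : ∀ {a b} {A : Set a} {B : Set b} k {f : A → ℕ} {g : A → List B} {xs} →
  All (λ x → f x ≤ k * length (g x)) xs → sum (map f xs) ≤ k * length (concatMap g xs)
sum-map≤*length-concatMap k []                         = z≤n
sum-map≤*length-concatMap k {f} {g} {x ∷ xs} (fx≤ ∷ fxs≤) = begin
  f x + sum (map f xs)                            ≤⟨ +-mono-≤ fx≤ (sum-map≤*length-concatMap k fxs≤) ⟩
  k * length (g x) + k * length (concatMap g xs)  ≡⟨ *-distribˡ-+ k (length (g x)) _ ⟨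
  k * (length (g x) + length (concatMap g xs))    ≡⟨ cong (k *_) (length-++ (g x)) ⟨
  k * length (concatMap g (x ∷ xs))               ∎
  where open ≤-Reasoning

-- Paths as vertex lists

module _ {ℓ} {A : Set ℓ} where

  last-++ : ∀ (xs : List A) y ys → last (xs ++ y ∷ ys) ≡ last (y ∷ ys)
  last-++ []           y ys = refl
  last-++ (x ∷ [])     y ys = refl
  last-++ (x ∷ x′ ∷ xs) y ys = last-++ (x′ ∷ xs) y ys

  last-reverse : (xs : List A) → last (reverse xs) ≡ head xs
  last-reverse []       = refl
  last-reverse (x ∷ xs) = trans (cong last (unfold-reverse x xs)) (last-++ (reverse xs) x [])

  head-reverse : (xs : List A) → head (reverse xs) ≡ last xs
  head-reverse xs = trans (sym (last-reverse (reverse xs))) (cong last (reverse-involutive xs))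

  reverse-split : ∀ (xs : List A) a b ys →
                  reverse (xs ++ a ∷ b ∷ ys) ≡ reverse ys ++ b ∷ a ∷ reverse xs
  reverse-split xs a b ys = begin
    reverse (xs ++ a ∷ b ∷ ys)                 ≡⟨ reverse-++ xs (a ∷ b ∷ ys) ⟩
    (ys ʳ++ b ∷ a ∷ []) ++ reverse xs          ≡⟨ cong (_++ reverse xs) (ʳ++-defn ys) ⟩
    (reverse ys ++ b ∷ a ∷ []) ++ reverse xs   ≡⟨ ++-assoc (reverse ys) (b ∷ a ∷ []) (reverse xs) ⟩
    reverse ys ++ b ∷ a ∷ reverse xs           ∎
    where open ≡-Reasoning

  Unique-reverse : ∀ {xs : List A} → Unique xs → Unique (reverse xs)
  Unique-reverse {xs} = Unique-resp-↭ (↭-sym (↭-reverse xs))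
    where
    open import Data.List.Relation.Binary.Permutation.Setoid (≡-setoid A) using (↭-sym)
    open import Data.List.Relation.Binary.Permutation.Setoid.Properties (≡-setoid A)
      using (Unique-resp-↭; ↭-reverse)

  Linked-reverse : ∀ {ℓ′} {R : A → A → Set ℓ′} → Symmetric R →
                   ∀ {xs} → Linked R xs → Linked R (reverse xs)
  Linked-reverse R-sym {[]}     []  = []
  Linked-reverse {R = R} R-sym {x ∷ xs} Rxs = subst (Linked R) (sym (unfold-reverse x xs))
    (Linked.++⁺ (Linked-reverse R-sym (Linked.tail Rxs)) last⟶x [-])
    where
    last⟶x : Connected R (last (reverse xs)) (just x)
    last⟶x = subst (λ m → Connected R m (just x)) (sym (last-reverse xs))
                    (Connected.sym R-sym (Linked.head′ Rxs))

  steps : List A → List (A × A)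
  steps (a ∷ b ∷ xs) = (a , b) ∷ steps (b ∷ xs)
  steps _            = []

  Step : A × A → List A → Set ℓ
  Step (a , b) xs = ∃₂ λ ys zs → xs ≡ ys ++ a ∷ b ∷ zs

  ∈-steps⁻ : ∀ {s xs} → s ∈ steps xs → Step s xs
  ∈-steps⁻ {xs = a ∷ b ∷ xs} (here refl) = [] , xs , refl
  ∈-steps⁻ {xs = a ∷ b ∷ xs} (there s∈)  =
    let ys , zs , eq = ∈-steps⁻ s∈ in a ∷ ys , zs , cong (a ∷_) eq

  Step-reverse : ∀ {s xs} → Step s xs → Step (swap s) (reverse xs)
  Step-reverse {a , b} (ys , zs , refl) = reverse zs , reverse ys , reverse-split ys a b zs

  Step⇒∈ : ∀ {a b xs} → Step (a , b) xs → a ∈ xs × b ∈ xs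
  Step⇒∈ (ys , _ , refl) = ∈-++⁺ʳ ys (here refl) , ∈-++⁺ʳ ys (there (here refl))

-- Colour classes

-- An edge {a, b} is stored with its smaller end first, as numEdges counts it.
toEdge : ∀ {n} → Fin n × Fin n → Fin n × Fin n
toEdge (a , b) = if does (a <? b) then (a , b) else (b , a)

module _ {n : ℕ} {a b : Fin n} where

  toEdge-< : a Fin.< b → toEdge (a , b) ≡ (a , b)
  toEdge-< a<b = cong (λ t → if t then (a , b) else (b , a)) (dec-true (a <? b) a<b)

  toEdge-≮ : ¬ a Fin.< b → toEdge (a , b) ≡ (b , a)
  toEdge-≮ a≮b = cong (λ t → if t then (a , b) else (b , a)) (dec-false (a <? b) a≮b)

toEdge-cases : ∀ {n} (s : Fin n × Fin n) → toEdge s ≡ s ⊎ toEdge s ≡ swap s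
toEdge-cases (a , b) with a <? b
... | yes a<b = inj₁ (toEdge-< a<b)
... | no a≮b  = inj₂ (toEdge-≮ a≮b)

toEdge-injective-up-to-swap : ∀ {n} {s t : Fin n × Fin n} → toEdge s ≡ toEdge t → s ≡ t ⊎ s ≡ swap t
toEdge-injective-up-to-swap {s = s} {t} eq with toEdge-cases s | toEdge-cases t
... | inj₁ s≡ | inj₁ t≡ = inj₁ (trans (sym s≡) (trans eq t≡))
... | inj₁ s≡ | inj₂ t≡ = inj₂ (trans (sym s≡) (trans eq t≡))
... | inj₂ s≡ | inj₁ t≡ = inj₂ (cong swap (trans (sym s≡) (trans eq t≡)))
... | inj₂ s≡ | inj₂ t≡ = inj₁ (cong swap (trans (sym s≡) (trans eq t≡)))

steps-distinct : ∀ {n} {P : List (Fin n)} → Unique P →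
                 AllPairs (λ s t → toEdge s ≢ toEdge t) (steps P)
steps-distinct {P = []}         _           = []
steps-distinct {P = _ ∷ []}     _           = []
steps-distinct {P = a ∷ b ∷ P} (a∉ ∷ uniq) = All.tabulate fresh ∷ steps-distinct uniq
  where
  fresh : ∀ {t} → t ∈ steps (b ∷ P) → toEdge (a , b) ≢ toEdge t
  fresh t∈ eq with Step⇒∈ (∈-steps⁻ t∈) | toEdge-injective-up-to-swap eq
  ... | c∈ , _  | inj₁ refl = All.lookup a∉ c∈ refl
  ... | _  , d∈ | inj₂ refl = All.lookup a∉ d∈ refl

_≟ᶜ_ : ∀ {k} (c d : Maybe (Fin k)) → Dec (c ≡ d)
_≟ᶜ_ = ≡-dec-Maybe _≟_

module _ {n} {G : Graph n} {Δ} (χ : PartialColoring G Δ) where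

  StepColoured : Fin (suc Δ) → Fin n × Fin n → Set
  StepColoured k (a , b) = col χ a b ≡ just k

  stepColoured? : ∀ k → U.Decidable (StepColoured k)
  stepColoured? k (a , b) = col χ a b ≟ᶜ just k

  ColouredEdge : Fin (suc Δ) → Fin n → Fin n → Set
  ColouredEdge k u v = col χ u v ≡ just k × u Fin.< v

  colouredEdge? : ∀ k → Decidable (ColouredEdge k)
  colouredEdge? k u v = (col χ u v ≟ᶜ just k) ×-dec (u <? v)

  colourClassSize : Fin (suc Δ) → ℕ
  colourClassSize k = card (colouredEdge? k)

  same-colour⇒≡ : ∀ {u v w k} → col χ u v ≡ just k → col χ u w ≡ just k → v ≡ w
  same-colour⇒≡ = proper χ _ _ _ _

  coloured⇒adjacent : ∀ {u v c} → col χ u v ≡ just c → adj G u v ≡ true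
  coloured⇒adjacent {u} {v} uv with adj G u v in e
  ... | true  = refl
  ... | false = contradiction (trans (sym uv) (col-edges χ u v e)) λ ()

  coloured⇒distinct : ∀ {u v c} → col χ u v ≡ just c → u ≢ v
  coloured⇒distinct {u} uv refl =
    contradiction (trans (sym (coloured⇒adjacent uv)) (irrefl G u)) λ ()

  toEdge-coloured : ∀ {k a b} → col χ a b ≡ just k → uncurry (ColouredEdge k) (toEdge (a , b))
  toEdge-coloured {k} {a} {b} ab with a <? b
  ... | yes a<b = subst (uncurry (ColouredEdge k)) (sym (toEdge-< a<b)) (ab , a<b)
  ... | no a≮b  = subst (uncurry (ColouredEdge k)) (sym (toEdge-≮ a≮b))
                    (trans (col-sym χ b a) ab , ≤∧≢⇒< (ℕ.≮⇒≥ a≮b) (coloured⇒distinct ab ∘ sym))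

  colourClassSize-pos : ∀ {k a b} → col χ a b ≡ just k → 0 < colourClassSize k
  colourClassSize-pos ab = length≤card (colouredEdge? _) ([] ∷ []) (toEdge-coloured ab ∷ [])

  at-most-one-colour : ∀ u v →
    ∑[ k < suc Δ ] 𝟙 (does (col χ u v ≟ᶜ just k) ∧ does (u <? v)) ≤ 𝟙 (adj G u v ∧ does (u <? v))
  at-most-one-colour u v with col χ u v in uv
  ... | nothing = ≤-trans (≤-reflexive (∑-zero {suc Δ} (λ _ → 0) (λ _ → refl))) z≤n
  ... | just c rewrite coloured⇒adjacent uv = ≤-reflexive (begin
    ∑[ k < suc Δ ] 𝟙 (does (just c ≟ᶜ just k) ∧ does (u <? v))
      ≡⟨ ∑-single (λ k → 𝟙 (does (just c ≟ᶜ just k) ∧ does (u <? v))) c other-colour ⟩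
    𝟙 (does (just c ≟ᶜ just c) ∧ does (u <? v))
      ≡⟨ cong (λ t → 𝟙 (t ∧ does (u <? v))) (dec-true (just c ≟ᶜ just c) refl) ⟩
    𝟙 (does (u <? v)) ∎)
    where
    open ≡-Reasoning
    other-colour : ∀ k → k ≢ c → 𝟙 (does (just c ≟ᶜ just k) ∧ does (u <? v)) ≡ 0
    other-colour k k≢c = cong (λ t → 𝟙 (t ∧ does (u <? v)))
                              (dec-false (just c ≟ᶜ just k) (k≢c ∘ sym ∘ just-injective))

  colourClassSizes≤numEdges : ∑[ k < suc Δ ] colourClassSize k ≤ numEdges G
  colourClassSizes≤numEdges = begin
    ∑[ k < suc Δ ] ∑[ u < n ] ∑[ v < n ] c k u v
      ≡⟨ ∑-comm (λ k u → ∑[ v < n ] c k u v) ⟩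
    ∑[ u < n ] ∑[ k < suc Δ ] ∑[ v < n ] c k u v
      ≡⟨ sum-cong-≗ (λ u → ∑-comm (λ k v → c k u v)) ⟩
    ∑[ u < n ] ∑[ v < n ] ∑[ k < suc Δ ] c k u v
      ≤⟨ ∑-mono-≤ (λ u → ∑-mono-≤ (at-most-one-colour u)) ⟩
    ∑[ u < n ] ∑[ v < n ] e u v
      ≡⟨ numEdges≡∑∑ ⟨
    numEdges G ∎
    where
    open ≤-Reasoning
    c : Fin (suc Δ) → Fin n → Fin n → ℕ
    c k u v = 𝟙 (does (colouredEdge? k u v))
    e : Fin n → Fin n → ℕ
    e u v = 𝟙 (adj G u v ∧ does (u <? v))
    numEdges≡∑∑ : numEdges G ≡ ∑[ u < n ] ∑[ v < n ] e u v
    numEdges≡∑∑ =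
      sumF≗∑ λ u → sumF≗∑ λ v → cong (λ b → 𝟙 (adj G u v ∧ b)) (isYes≗does (u <? v))

  ∑-except-colourClassSize<numEdges : ∀ x → 0 < colourClassSize x →
                                      ∑-except x colourClassSize < numEdges G
  ∑-except-colourClassSize<numEdges x 0<Cx = begin-strict
    ∑-except x colourClassSize                     <⟨ m<m+n _ 0<Cx ⟩
    ∑-except x colourClassSize + colourClassSize x ≡⟨ ∑-except-+ x colourClassSize ⟩
    ∑[ k < suc Δ ] colourClassSize k               ≤⟨ colourClassSizes≤numEdges ⟩
    numEdges G                                     ∎
    where open ≤-Reasoning

-- Alternating paths

module AlternatingPaths {n} {G : Graph n} {Δ} (χ : PartialColoring G Δ) (x y : Fin (suc Δ)) where

  XY : Fin n → Fin n → Set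
  XY = XYEdge χ x y

  XY-sym : Symmetric XY
  XY-sym {a} {b} = Sum.map (trans (col-sym χ b a)) (trans (col-sym χ b a))

  MissesXY : Fin n → Set
  MissesXY t = Miss χ t x ⊎ Miss χ t y

  alternate : ∀ {a b c} → XY b a → XY b c → a ≢ c →
              col χ b a ≡ just x × col χ b c ≡ just y ⊎ col χ b a ≡ just y × col χ b c ≡ just x
  alternate (inj₁ ba) (inj₁ bc) a≢c = ⊥-elim (a≢c (same-colour⇒≡ χ ba bc))
  alternate (inj₁ ba) (inj₂ bc) _   = inj₁ (ba , bc)
  alternate (inj₂ ba) (inj₁ bc) _   = inj₂ (ba , bc)
  alternate (inj₂ ba) (inj₂ bc) a≢c = ⊥-elim (a≢c (same-colour⇒≡ χ ba bc))

  two-neighbours⇒¬misses : ∀ {a b c} → XY b a → XY b c → a ≢ c → ¬ MissesXY b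
  two-neighbours⇒¬misses {a} {b} {c} ba bc a≢c b-misses with alternate ba bc a≢c | b-misses
  ... | inj₁ (bax , _) | inj₁ b-x = b-x a bax
  ... | inj₁ (_ , bcy) | inj₂ b-y = b-y c bcy
  ... | inj₂ (_ , bcx) | inj₁ b-x = b-x c bcx
  ... | inj₂ (bay , _) | inj₂ b-y = b-y a bay

  third-neighbour-unique : ∀ {a b c c′} → XY b a → XY b c → XY b c′ → a ≢ c → a ≢ c′ → c ≡ c′
  third-neighbour-unique (inj₁ _)  (inj₂ bc) (inj₂ bc′) _ _ = same-colour⇒≡ χ bc bc′
  third-neighbour-unique (inj₂ _)  (inj₁ bc) (inj₁ bc′) _ _ = same-colour⇒≡ χ bc bc′
  third-neighbour-unique (inj₁ ba) (inj₁ bc) _ a≢c _ = ⊥-elim (a≢c (same-colour⇒≡ χ ba bc))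
  third-neighbour-unique (inj₂ ba) (inj₂ bc) _ a≢c _ = ⊥-elim (a≢c (same-colour⇒≡ χ ba bc))
  third-neighbour-unique (inj₁ ba) (inj₂ _) (inj₁ bc′) _ a≢c′ =
    ⊥-elim (a≢c′ (same-colour⇒≡ χ ba bc′))
  third-neighbour-unique (inj₂ ba) (inj₁ _) (inj₂ bc′) _ a≢c′ =
    ⊥-elim (a≢c′ (same-colour⇒≡ χ ba bc′))

  continuation-unique : ∀ {a b B B′} →
    IsAltPath χ x y (a ∷ b ∷ B)  → MaybeAll MissesXY (last (b ∷ B)) →
    IsAltPath χ x y (a ∷ b ∷ B′) → MaybeAll MissesXY (last (b ∷ B′)) → B ≡ B′
  continuation-unique {B = []}    {[]}    _ _ _ _ = refl
  continuation-unique {B = []} {_ ∷ _} _ (just b-misses) ((_ ∷ a≢c ∷ _) ∷ _ , ab ∷ bc ∷ _) _ =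
    ⊥-elim (two-neighbours⇒¬misses (XY-sym ab) bc a≢c b-misses)
  continuation-unique {B = _ ∷ _} {[]} ((_ ∷ a≢c ∷ _) ∷ _ , ab ∷ bc ∷ _) _ _ (just b-misses) =
    ⊥-elim (two-neighbours⇒¬misses (XY-sym ab) bc a≢c b-misses)
  continuation-unique {B = c ∷ _} {_ ∷ _}
    ((_ ∷ a≢c ∷ _) ∷ uniq , ab ∷ alt) end ((_ ∷ a≢c′ ∷ _) ∷ uniq′ , _ ∷ alt′) end′
    with refl ← third-neighbour-unique (XY-sym ab) (Linked.head alt) (Linked.head alt′) a≢c a≢c′
    = cong (c ∷_) (continuation-unique (uniq , alt) end (uniq′ , alt′) end′)

  IsAltPath-suffix : ∀ A {L} → IsAltPath χ x y (A ++ L) → IsAltPath χ x y L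
  IsAltPath-suffix []      p                  = p
  IsAltPath-suffix (_ ∷ A) (_ ∷ uniq , alt)   = IsAltPath-suffix A (uniq , Linked.tail alt)

  suffix-determined : ∀ {A a b B A′ B′} → IsMaximalAltPath χ x y (A ++ a ∷ b ∷ B) →
                      IsMaximalAltPath χ x y (A′ ++ a ∷ b ∷ B′) → B ≡ B′
  suffix-determined {A} {a} {b} {B} {A′} {B′}
    (alt , _ , _ , _ , last≡t , _ , t-misses) (alt′ , _ , _ , _ , last≡t′ , _ , t′-misses) =
    continuation-unique (IsAltPath-suffix A alt) (last-misses A B last≡t t-misses)
                        (IsAltPath-suffix A′ alt′) (last-misses A′ B′ last≡t′ t′-misses)
    where
    last-misses : ∀ A B {t} → last (A ++ a ∷ b ∷ B) ≡ just t → MissesXY t →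
                  MaybeAll MissesXY (last (b ∷ B))
    last-misses A B last≡t t-misses =
      subst (MaybeAll MissesXY) (trans (sym last≡t) (last-++ A a (b ∷ B))) (just t-misses)

  IsMaximalAltPath-reverse : ∀ {P} → IsMaximalAltPath χ x y P → IsMaximalAltPath χ x y (reverse P)
  IsMaximalAltPath-reverse {P} ((uniq , alt) , s , t , head≡s , last≡t , s-misses , t-misses) =
    (Unique-reverse uniq , Linked-reverse XY-sym alt) , t , s ,
    trans (head-reverse P) last≡t , trans (last-reverse P) head≡s , t-misses , s-misses

  step-determines-path : ∀ {s P Q} → IsMaximalAltPath χ x y P → IsMaximalAltPath χ x y Q →
                         Step s P → Step s Q → P ≡ Q
  step-determines-path {a , b} maxP maxQ (A , B , refl) (A′ , B′ , refl) =
    cong₂ (λ A B → A ++ a ∷ b ∷ B) (reverse-injective reverse-prefixes) (suffix-determined maxP maxQ)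
    where
    reverse-prefixes : reverse A ≡ reverse A′
    reverse-prefixes = suffix-determined
      (subst (IsMaximalAltPath χ x y) (reverse-split A a b B) (IsMaximalAltPath-reverse maxP))
      (subst (IsMaximalAltPath χ x y) (reverse-split A′ a b B′) (IsMaximalAltPath-reverse maxQ))

  ySteps : List (Fin n) → List (Fin n × Fin n)
  ySteps P = filter (stepColoured? χ y) (steps P)

  yEdges : List (Fin n) → List (Fin n × Fin n)
  yEdges P = map toEdge (ySteps P)

  yEdges-coloured : ∀ P → All (uncurry (ColouredEdge χ y)) (yEdges P)
  yEdges-coloured P = All-map⁺ (All.map (λ { {_ , _} ab → toEdge-coloured χ ab })
                                        (all-filter (stepColoured? χ y) (steps P)))

  yEdges-unique : ∀ {P} → Unique P → Unique (yEdges P)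
  yEdges-unique uniq = AllPairs.map⁺ (AllPairs.filter⁺ (stepColoured? χ y) (steps-distinct uniq))

  ∈-yEdges⁻ : ∀ {e P} → e ∈ yEdges P → ∃ λ s → Step s P × e ≡ toEdge s
  ∈-yEdges⁻ e∈ with ∈-map∘filter⁻ toEdge (stepColoured? χ y) e∈
  ... | s , s∈ , e≡ , _ = s , ∈-steps⁻ s∈ , e≡

  shared-yEdge⇒same-path : ∀ {e P Q} → IsMaximalAltPath χ x y P → IsMaximalAltPath χ x y Q →
                e ∈ yEdges P → e ∈ yEdges Q → P ≡ Q ⊎ P ≡ reverse Q
  shared-yEdge⇒same-path maxP maxQ e∈P e∈Q with ∈-yEdges⁻ e∈P | ∈-yEdges⁻ e∈Q
  ... | _ , sP , refl | _ , tQ , eq with toEdge-injective-up-to-swap eq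
  ...   | inj₁ refl = inj₁ (step-determines-path maxP maxQ sP tQ)
  ...   | inj₂ refl = inj₂ (step-determines-path maxP (IsMaximalAltPath-reverse maxQ) sP (Step-reverse tQ))

  both-colours-occur : ∀ {P} → IsAltPath χ x y P → 2 ≤ pathLength P →
                       Any (StepColoured χ x) (steps P) × Any (StepColoured χ y) (steps P)
  both-colours-occur {[]}          _ ()
  both-colours-occur {_ ∷ []}      _ ()
  both-colours-occur {_ ∷ _ ∷ []}  _ (s≤s ())
  both-colours-occur {a ∷ b ∷ _ ∷ _} ((_ ∷ a≢c ∷ _) ∷ _ , ab ∷ bc ∷ _) _
    with alternate (XY-sym ab) bc a≢c
  ... | inj₁ (bax , bcy) = here (trans (col-sym χ a b) bax) , there (here bcy)
  ... | inj₂ (bay , bcx) = there (here bcx) , here (trans (col-sym χ a b) bay)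

  -- Matching on the test of filter also unfolds ySteps (a ∷ b ∷ R) in the goals.
  pathLength≤1+2*ySteps : ∀ {a R} → IsAltPath χ x y (a ∷ R) →
                          pathLength (a ∷ R) ≤ 1 + 2 * length (ySteps (a ∷ R))
  pathLength≤1+2*ySteps {R = []} _ = z≤n
  pathLength≤1+2*ySteps {a} {b ∷ R} (_ ∷ uniq , ab ∷ alt) with stepColoured? χ y (a , b)
  ... | yes _ = let open ≤-Reasoning in begin
    suc (length R)                      ≤⟨ s≤s (m≤n⇒m≤1+n (pathLength≤1+2*ySteps (uniq , alt))) ⟩
    3 + 2 * length (ySteps (b ∷ R))     ≡⟨ cong suc (*-suc 2 _) ⟨
    1 + 2 * suc (length (ySteps (b ∷ R))) ∎
  pathLength≤1+2*ySteps {a} {b ∷ []} _ | no _ = s≤s z≤n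
  pathLength≤1+2*ySteps {a} {b ∷ c ∷ R} ((_ ∷ a≢c ∷ _) ∷ _ ∷ uniq , ab ∷ bc ∷ alt) | no ¬aby
    with alternate (XY-sym ab) bc a≢c
  ... | inj₂ (bay , _) = contradiction (trans (col-sym χ a b) bay) ¬aby
  ... | inj₁ (_ , bcy) = let open ≤-Reasoning in begin
    suc (suc (length R))                ≤⟨ s≤s (s≤s (pathLength≤1+2*ySteps (uniq , alt))) ⟩
    3 + 2 * length (ySteps (c ∷ R))     ≡⟨ cong suc (*-suc 2 _) ⟨
    1 + 2 * suc (length (ySteps (c ∷ R)))
      ≡⟨ cong (λ l → 1 + 2 * length l) (filter-accept (stepColoured? χ y) bcy) ⟨
    1 + 2 * length (ySteps (b ∷ c ∷ R)) ∎

  pathLength≤3*yEdges : ∀ {P} → IsAltPath χ x y P → 2 ≤ pathLength P →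
                        pathLength P ≤ 3 * length (yEdges P)
  pathLength≤3*yEdges {[]}    _   ()
  pathLength≤3*yEdges {a ∷ R} alt 2≤ = begin
    pathLength (a ∷ R)                ≤⟨ pathLength≤1+2*ySteps alt ⟩
    1 + 2 * length (ySteps (a ∷ R))   ≤⟨ +-monoˡ-≤ (2 * length (ySteps (a ∷ R))) y-step-exists ⟩
    3 * length (ySteps (a ∷ R))       ≡⟨ cong (3 *_) (length-map toEdge (ySteps (a ∷ R))) ⟨
    3 * length (yEdges (a ∷ R))       ∎
    where
    open ≤-Reasoning
    y-step-exists : 1 ≤ length (ySteps (a ∷ R))
    y-step-exists = filter-some (stepColoured? χ y) (proj₂ (both-colours-occur alt 2≤))

  yEdges-disjoint : ∀ {Ps} → All (IsMaximalAltPath χ x y) Ps →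
                    AllPairs (λ P Q → P ≢ Q × P ≢ reverse Q) Ps →
                    AllPairs (λ P Q → Disjoint (yEdges P) (yEdges Q)) Ps
  yEdges-disjoint []             []                 = []
  yEdges-disjoint (maxP ∷ maxPs) (P-distinct ∷ Ps-distinct) =
    All.zipWith (λ (maxQ , P≢Q , P≢Q′) {_} (e∈P , e∈Q) →
                   Sum.[ P≢Q , P≢Q′ ] (shared-yEdge⇒same-path maxP maxQ e∈P e∈Q))
                (maxPs , P-distinct)
    ∷ yEdges-disjoint maxPs Ps-distinct

  totalLength≤3*colourClassSize : ∀ {Ps} → EnumeratesLongMaxAltPaths χ x y Ps →
                                  totalLength Ps ≤ 3 * colourClassSize χ y
  totalLength≤3*colourClassSize {Ps} (long , _ , distinct) = begin
    totalLength Ps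
      ≤⟨ sum-map≤*length-concatMap 3 (All.map (uncurry (pathLength≤3*yEdges ∘ proj₁)) longs) ⟩
    3 * length (concatMap yEdges Ps)
      ≤⟨ *-monoʳ-≤ 3 (length≤card (colouredEdge? χ y) unique coloured) ⟩
    3 * colourClassSize χ y ∎
    where
    open ≤-Reasoning
    longs : All (λ P → IsMaximalAltPath χ x y P × 2 ≤ pathLength P) Ps
    longs = All.tabulate (long _)
    unique : Unique (concatMap yEdges Ps)
    unique = Unique.concat⁺ (All-map⁺ (All.map (yEdges-unique ∘ proj₁ ∘ proj₁ ∘ proj₁) longs))
                            (AllPairs.map⁺ (yEdges-disjoint (All.map proj₁ longs) distinct))
    coloured : All (uncurry (ColouredEdge χ y)) (concatMap yEdges Ps)
    coloured = concat⁺ (All-map⁺ (All.universal yEdges-coloured Ps))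

  long-path⇒x-coloured : ∀ {P} → IsAltPath χ x y P → 2 ≤ pathLength P → 0 < colourClassSize χ x
  long-path⇒x-coloured alt 2≤ =
    colourClassSize-pos χ (proj₂ (Any.satisfied (proj₁ (both-colours-occur alt 2≤))))

  no-x-edges⇒totalLength≡0 : ∀ {Ps} → colourClassSize χ x ≡ 0 →
                             EnumeratesLongMaxAltPaths χ x y Ps → totalLength Ps ≡ 0
  no-x-edges⇒totalLength≡0 {[]}    _    _          = refl
  no-x-edges⇒totalLength≡0 {P ∷ _} Cx≡0 (long , _) =
    let (maxP , 2≤) = long P (here refl)
    in  contradiction (subst (0 <_) Cx≡0 (long-path⇒x-coloured (proj₁ maxP) 2≤)) λ ()

open AlternatingPaths using (totalLength≤3*colourClassSize; no-x-edges⇒totalLength≡0)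

lemma9p4 : ∀ {n} (G : Graph n) (Δ : ℕ) → IsMaxDegree G Δ → 0 < numEdges G →
    (χ : PartialColoring G Δ) (x : Fin (suc Δ)) →
    (Ps : (y : Fin (suc Δ)) → List (List (Fin n))) →
    (∀ y → y ≢ x → EnumeratesLongMaxAltPaths χ x y (Ps y)) →
    sumOverOthers x Ps < 3 * numEdges G
lemma9p4 G Δ _ 0<m χ x Ps enum = begin-strict
  sumOverOthers x Ps   ≡⟨ sumF≗∑ (λ y → cong (λ b → if b then 0 else L y) (isYes≗does (y ≟ x))) ⟩
  ∑-except x L         <⟨ bound ⟩
  3 * numEdges G       ∎
  where
  open ≤-Reasoning
  L C : Fin (suc Δ) → ℕ
  L y = totalLength (Ps y)
  C   = colourClassSize χ
  bound : ∑-except x L < 3 * numEdges G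
  bound with C x ℕ.≟ 0
  ... | yes Cx≡0 = begin-strict
    ∑-except x L
      ≡⟨ ∑-except-zero x L (λ y y≢x → no-x-edges⇒totalLength≡0 χ x y Cx≡0 (enum y y≢x)) ⟩
    0                    <⟨ *-monoʳ-< 3 0<m ⟩
    3 * numEdges G       ∎
  ... | no Cx≢0 = begin-strict
    ∑-except x L
      ≤⟨ ∑-except-≤-* x 3 L C (λ y y≢x → totalLength≤3*colourClassSize χ x y (enum y y≢x)) ⟩
    3 * ∑-except x C     <⟨ *-monoʳ-< 3 (∑-except-colourClassSize<numEdges χ x (n≢0⇒n>0 Cx≢0)) ⟩
    3 * numEdges G       ∎
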